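{- There exist an infinite family $\mathcal{F}$ of trees and a constant $c>0$ such that for every tree $T\in\mathcal{F}$ with $n\ge 2$ vertices, every choice of two vertex subsets $V_1,V_2$ of $T$ such that every edge of $T$ has both endpoints in $V_1$ or both endpoints in $V_2$ satisfies $\max\{|V_1|,|V_2|\}\ \ge\ \lfloor n/2\rfloor + c\log n$. Equivalently, the optimum value of $\textsc{Cover}(T,2)$ is at least $\lfloor n/2\rfloor+\Omega(\log n)$ for all $T\in\mathcal{F}$.
   Context: For a graph $G=(V,E)$ and integer $k\ge1$, $\textsc{Cover}(G,k)$ is the problem of choosing subsets $V_1,\dots,V_k\subseteq V$ such that every edge of $G$ has both endpoints in some $V_i$ (i.e. the induced subgraphs $G[V_i]$ together cover $G$), minimizing $\max_i|V_i|$; the minimum is the optimum value (cost) of $\textsc{Cover}(G,k)$. -}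

module Defs where

open import Data.Nat using (ℕ; _≤_; _⊔_)
open import Data.Bool using (Bool; true; false)
open import Data.Fin using (Fin)
open import Data.Fin.Subset using (Subset; _∈_; ∣_∣)
open import Data.List using (List; []; _∷_; _++_; length)
open import Data.List.Relation.Unary.Unique.Propositional using (Unique)
open import Data.Product using (Σ; Σ-syntax; _×_)
open import Data.Sum using (_⊎_)
open import Data.Empty using (⊥)
open import Relation.Nullary using (¬_)
open import Relation.Binary.PropositionalEquality using (_≡_)
open import Relation.Binary.Construct.Closure.ReflexiveTransitive using (Star)

record Graph (n : ℕ) : Set where
  field
    adj   : Fin n → Fin n → Bool
    sym   : ∀ u v → adj u v ≡ adj v u
    loopless : ∀ u → adj u u ≡ false

module _ {n : ℕ} (G : Graph n) where
  open Graph G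

  Edge : Fin n → Fin n → Set
  Edge u v = adj u v ≡ true

  Connected : Set
  Connected = ∀ u v → Star Edge u v

  data Chain : List (Fin n) → Set where
    chain-[]  : Chain []
    chain-[x] : ∀ x → Chain (x ∷ [])
    chain-∷   : ∀ x y zs → Edge x y → Chain (y ∷ zs) → Chain (x ∷ y ∷ zs)

  Cycle : Set
  Cycle = Σ[ x ∈ Fin n ] Σ[ ys ∈ List (Fin n) ] Σ[ y ∈ Fin n ]
            (1 ≤ length ys × Unique (x ∷ ys ++ y ∷ []) ×
             Chain (x ∷ ys ++ y ∷ []) × Edge y x)

  Acyclic : Set
  Acyclic = ¬ Cycle

  Covers2 : Subset n → Subset n → Set
  Covers2 V₁ V₂ = ∀ u v → Edge u v → (u ∈ V₁ × v ∈ V₁) ⊎ (u ∈ V₂ × v ∈ V₂)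

record Tree (n : ℕ) : Set where
  field
    graph     : Graph n
    connected : Connected graph
    acyclic   : Acyclic graph
open Tree public

-- The trees: a root joined to the tops of blocks B₀, …, B_{m-1}, where B_j is a vertex with a
-- single child carrying a perfect binary tree of height 2j+2. Thus |B_j| = 4^(j+1) and
-- n = 1 + 4 + ⋯ + 4^m.
--
-- Take a cover (V₁, V₂) and call a vertex shared if it lies in both sets. All subtrees of a
-- perfect binary tree have sizes 2^h − 1, so if the top of a block B lies in V₁ and B has c′
-- shared vertices, then |B| + |B ∩ V₂| − |B ∩ V₁| is a sum of at most 5c′ terms ±2^a. Let u and
-- v be the total sizes of the blocks whose top lies in V₁, resp. only in V₂. Then
-- |V₁| − |V₂| − (u − v) is a sum of O(c + 1) signed powers of two, c being the number of shared
-- vertices. But u + v = 4 + 16 + ⋯ + 4^m has 2m alternations in its binary expansion, u and v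
-- are sums of m powers of two altogether, and adding ±2^a changes the number of alternations by
-- at most 2; this forces u − v to need at least m/2 signed powers of two. Hence
-- ||V₁| − |V₂|| + c = Ω(m), and 2 max(|V₁|, |V₂|) = n + c + ||V₁| − |V₂|| ≥ n + Ω(log n).

module Submission where

open import Defs
open import Data.Nat
  using (ℕ; zero; suc; _+_; _*_; _^_; _/_; _⊔_; ∣_-_∣; ⌊_/2⌋; _≤_; _<_; _≤′_; ≤′-refl; ≤′-step; z≤n; s≤s; s≤s⁻¹; _≟_; _<?_)
import Data.Nat.Properties as ℕ
open import Data.Nat.DivMod using (m<n*o⇒m/o<n)
open import Data.Nat.Logarithm using (⌊log₂_⌋; ⌊log₂⌋-mono-≤; ⌊log₂[2^n]⌋≡n)
open import Data.Nat.Tactic.RingSolver using () renaming (solve-∀ to ℕ-solve-∀)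
open import Data.Bool using (Bool; true; false; not; _xor_)
import Data.Bool.Properties as Bool
open import Data.Integer using (ℤ; +_; -_; +0) renaming (_+_ to _+ℤ_; _-_ to _-ℤ_; _*_ to _*ℤ_)
import Data.Integer.Properties as ℤ
open import Data.Integer.Tactic.RingSolver using (solve-∀)
open import Data.Fin as Fin using (Fin; toℕ; fromℕ<)
open import Data.Fin.Properties using (toℕ-injective; toℕ<n; toℕ-fromℕ<)
open import Data.Fin.Subset using (Subset; _∈_; ∣_∣)
open import Data.List using (List; []; _∷_; _++_)
open import Data.List.Relation.Unary.All as All using (All; _∷_)
import Data.List.Relation.Unary.All.Properties as All
open import Data.List.Relation.Unary.AllPairs using (_∷_)
open import Data.List.Relation.Unary.Unique.Propositional using (Unique)
open import Data.Vec using ([]; _∷_; here; there)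
open import Data.Product as Prod using (Σ; Σ-syntax; ∃-syntax; _×_; _,_; proj₁; proj₂)
open import Data.Sum as Sum using (_⊎_; inj₁; inj₂; [_,_])
open import Function using (_∘_; _⟨_⟩_; flip)
open import Relation.Nullary using (¬_; Dec; does; yes; no; contradiction)
open import Relation.Nullary.Decidable using (¬?; _×-dec_; _⊎-dec_; dec-true; dec-false)
open import Relation.Binary.PropositionalEquality using (_≡_; _≢_; refl; sym; trans; cong; cong₂; subst; subst₂)
open import Relation.Binary.Construct.Closure.ReflexiveTransitive using (Star; ε; _◅_; _◅◅_; reverse)

-- Sums of signed powers of two

data Pow2Sum : ℕ → ℤ → Set where
  []    : ∀ {w} → Pow2Sum w +0
  plus  : ∀ {w x} a → Pow2Sum w x → Pow2Sum (suc w) (x +ℤ + 2 ^ a)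
  minus : ∀ {w x} a → Pow2Sum w x → Pow2Sum (suc w) (x -ℤ + 2 ^ a)

pow2Sum-mono : ∀ {w w′ x} → w ≤ w′ → Pow2Sum w x → Pow2Sum w′ x
pow2Sum-mono _          []          = []
pow2Sum-mono (s≤s w≤w′) (plus a s)  = plus a (pow2Sum-mono w≤w′ s)
pow2Sum-mono (s≤s w≤w′) (minus a s) = minus a (pow2Sum-mono w≤w′ s)

pow2Sum-+ : ∀ {w w′ x y} → Pow2Sum w x → Pow2Sum w′ y → Pow2Sum (w + w′) (x +ℤ y)
pow2Sum-+ {w} {y = y} [] t = subst (Pow2Sum _) (sym (ℤ.+-identityˡ y)) (pow2Sum-mono (ℕ.m≤n+m _ w) t)
pow2Sum-+ {y = y} (plus {x = x} a s) t = subst (Pow2Sum _) (swap x y (+ 2 ^ a)) (plus a (pow2Sum-+ s t))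
  where swap : ∀ x y k → (x +ℤ y) +ℤ k ≡ (x +ℤ k) +ℤ y
        swap = solve-∀
pow2Sum-+ {y = y} (minus {x = x} a s) t = subst (Pow2Sum _) (swap x y (+ 2 ^ a)) (minus a (pow2Sum-+ s t))
  where swap : ∀ x y k → (x +ℤ y) -ℤ k ≡ (x -ℤ k) +ℤ y
        swap = solve-∀

pow2Sum-neg : ∀ {w x} → Pow2Sum w x → Pow2Sum w (- x)
pow2Sum-neg []                  = []
pow2Sum-neg (plus {x = x} a s)  = subst (Pow2Sum _) (neg x (+ 2 ^ a)) (minus a (pow2Sum-neg s))
  where neg : ∀ x k → - x -ℤ k ≡ - (x +ℤ k)
        neg = solve-∀
pow2Sum-neg (minus {x = x} a s) = subst (Pow2Sum _) (neg x (+ 2 ^ a)) (plus a (pow2Sum-neg s))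
  where neg : ∀ x k → - x +ℤ k ≡ - (x -ℤ k)
        neg = solve-∀

pow2Sum-- : ∀ {w w′ x y} → Pow2Sum w x → Pow2Sum w′ y → Pow2Sum (w + w′) (x -ℤ y)
pow2Sum-- s t = pow2Sum-+ s (pow2Sum-neg t)

pow2Sum-double : ∀ {w x} → Pow2Sum w x → Pow2Sum w (+ 2 *ℤ x)
pow2Sum-double []                  = []
pow2Sum-double (plus {x = x} a s) =
  subst (Pow2Sum _) (trans (cong (λ t → + 2 *ℤ x +ℤ t) (ℤ.pos-* 2 (2 ^ a))) (distrib x (+ 2 ^ a)))
    (plus (suc a) (pow2Sum-double s))
  where distrib : ∀ x k → + 2 *ℤ x +ℤ + 2 *ℤ k ≡ + 2 *ℤ (x +ℤ k)
        distrib = solve-∀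
pow2Sum-double (minus {x = x} a s) =
  subst (Pow2Sum _) (trans (cong (λ t → + 2 *ℤ x -ℤ t) (ℤ.pos-* 2 (2 ^ a))) (distrib x (+ 2 ^ a)))
    (minus (suc a) (pow2Sum-double s))
  where distrib : ∀ x k → + 2 *ℤ x -ℤ + 2 *ℤ k ≡ + 2 *ℤ (x -ℤ k)
        distrib = solve-∀

pow2Sum-2^ : ∀ a → Pow2Sum 1 (+ 2 ^ a)
pow2Sum-2^ a = subst (Pow2Sum 1) (ℤ.+-identityˡ _) (plus a [])

pow2Sum-ℕ : ∀ k → Pow2Sum k (+ k)
pow2Sum-ℕ zero    = []
pow2Sum-ℕ (suc k) = subst (Pow2Sum (suc k)) (cong +_ (ℕ.+-comm k 1)) (plus 0 (pow2Sum-ℕ k))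

pow2Sum-∣-∣ : ∀ a b → Pow2Sum ∣ a - b ∣ (+ a -ℤ + b)
pow2Sum-∣-∣ zero    zero    = []
pow2Sum-∣-∣ zero    (suc b) = subst (Pow2Sum (suc b)) (sym (ℤ.+-identityˡ _)) (pow2Sum-neg (pow2Sum-ℕ (suc b)))
pow2Sum-∣-∣ (suc a) zero    = subst (Pow2Sum (suc a)) (sym (ℤ.+-identityʳ _)) (pow2Sum-ℕ (suc a))
pow2Sum-∣-∣ (suc a) (suc b) = subst (Pow2Sum ∣ a - b ∣) (shift (+ a) (+ b)) (pow2Sum-∣-∣ a b)
  where shift : ∀ a b → a -ℤ b ≡ (+ 1 +ℤ a) -ℤ (+ 1 +ℤ b)
        shift = solve-∀

-- Alternations in binary expansions

boolToℕ : Bool → ℕ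
boolToℕ false = 0
boolToℕ true  = 1

lowBit : ℕ → Bool
lowBit zero          = false
lowBit (suc zero)    = true
lowBit (suc (suc n)) = lowBit n

-- The number of i < W such that bit i of x differs from bit i − 1, where bit −1 is b.
alternations : ℕ → ℕ → Bool → ℕ
alternations zero    x b = 0
alternations (suc W) x b = boolToℕ (b xor lowBit x) + alternations W ⌊ x /2⌋ (lowBit x)

data Parity : ℕ → Set where
  even : ∀ y → Parity (y + y)
  odd  : ∀ y → Parity (suc (y + y))

parity : ∀ x → Parity x
parity zero          = even zero
parity (suc zero)    = odd zero
parity (suc (suc x)) with parity x
... | even y = subst Parity (cong suc (ℕ.+-suc y y)) (even (suc y))
... | odd y  = subst Parity (cong (suc ∘ suc) (ℕ.+-suc y y)) (odd (suc y))

lowBit-even : ∀ y → lowBit (y + y) ≡ false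
lowBit-even zero    = refl
lowBit-even (suc y) rewrite ℕ.+-suc y y = lowBit-even y

lowBit-odd : ∀ y → lowBit (suc (y + y)) ≡ true
lowBit-odd zero    = refl
lowBit-odd (suc y) rewrite ℕ.+-suc y y = lowBit-odd y

⌊1+y+y/2⌋≡y : ∀ y → ⌊ suc (y + y) /2⌋ ≡ y
⌊1+y+y/2⌋≡y zero    = refl
⌊1+y+y/2⌋≡y (suc y) rewrite ℕ.+-suc y y = cong suc (⌊1+y+y/2⌋≡y y)

alternations-even : ∀ W y b → alternations (suc W) (y + y) b ≡ boolToℕ b + alternations W y false
alternations-even W y b rewrite lowBit-even y | sym (ℕ.n≡⌊n+n/2⌋ y) | Bool.xor-identityʳ b = refl

alternations-odd : ∀ W y b → alternations (suc W) (suc (y + y)) b ≡ boolToℕ (not b) + alternations W y true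
alternations-odd W y b rewrite lowBit-odd y | ⌊1+y+y/2⌋≡y y | Bool.xor-comm b true = refl

alternations-2+y+y : ∀ W y b → alternations (suc W) (suc (suc (y + y))) b ≡ boolToℕ b + alternations W (suc y) false
alternations-2+y+y W y b =
  trans (cong (λ x → alternations (suc W) x b) (sym (ℕ.+-suc (suc y) y))) (alternations-even W (suc y) b)

alternations-zero : ∀ W → alternations W 0 false ≡ 0
alternations-zero zero    = refl
alternations-zero (suc W) = alternations-zero W

∣m+o-n+o∣≡∣m-n∣ : ∀ m n o → ∣ m + o - (n + o) ∣ ≡ ∣ m - n ∣
∣m+o-n+o∣≡∣m-n∣ m n o =
  trans (cong₂ ∣_-_∣ (ℕ.+-comm m o) (ℕ.+-comm n o)) (ℕ.∣m+n-m+o∣≡∣n-o∣ o m n)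

∣m+o-n+p∣≤∣m-n∣+∣o-p∣ : ∀ m n o p → ∣ m + o - (n + p) ∣ ≤ ∣ m - n ∣ + ∣ o - p ∣
∣m+o-n+p∣≤∣m-n∣+∣o-p∣ m n o p = begin
  ∣ m + o - (n + p) ∣
    ≤⟨ ℕ.∣-∣-triangle (m + o) (n + o) (n + p) ⟩
  ∣ m + o - (n + o) ∣ + ∣ n + o - (n + p) ∣
    ≡⟨ cong₂ _+_ (∣m+o-n+o∣≡∣m-n∣ m n o) (ℕ.∣m+n-m+o∣≡∣n-o∣ n o p) ⟩
  ∣ m - n ∣ + ∣ o - p ∣ ∎
  where open ℕ.≤-Reasoning

∣not-b-b∣≤1 : ∀ b → ∣ boolToℕ (not b) - boolToℕ b ∣ ≤ 1
∣not-b-b∣≤1 false = s≤s z≤n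
∣not-b-b∣≤1 true  = s≤s z≤n

alternations-flip : ∀ W y → ∣ alternations W y true - alternations W y false ∣ ≤ 1
alternations-flip zero    y = z≤n
alternations-flip (suc W) y = begin
  ∣ boolToℕ (not b) + R - (boolToℕ b + R) ∣ ≡⟨ ∣m+o-n+o∣≡∣m-n∣ (boolToℕ (not b)) (boolToℕ b) R ⟩
  ∣ boolToℕ (not b) - boolToℕ b ∣           ≤⟨ ∣not-b-b∣≤1 b ⟩
  1                                         ∎
  where
  open ℕ.≤-Reasoning
  b = lowBit y
  R = alternations W ⌊ y /2⌋ b

alternations-suc : ∀ W y → ∣ alternations W (suc y) false - alternations W y true ∣ ≤ 1
alternations-suc zero    y = z≤n
alternations-suc (suc W) y with parity y
... | even z = begin
  ∣ alternations (suc W) (suc (z + z)) false - alternations (suc W) (z + z) true ∣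
    ≡⟨ cong₂ ∣_-_∣ (alternations-odd W z false) (alternations-even W z true) ⟩
  ∣ alternations W z true - alternations W z false ∣
    ≤⟨ alternations-flip W z ⟩
  1 ∎
  where open ℕ.≤-Reasoning
... | odd z = begin
  ∣ alternations (suc W) (suc (suc (z + z))) false - alternations (suc W) (suc (z + z)) true ∣
    ≡⟨ cong₂ ∣_-_∣ (alternations-2+y+y W z false) (alternations-odd W z true) ⟩
  ∣ alternations W (suc z) false - alternations W z true ∣
    ≤⟨ alternations-suc W z ⟩
  1 ∎
  where open ℕ.≤-Reasoning

y+y+2k≡[y+k]+[y+k] : ∀ y k → y + y + 2 * k ≡ (y + k) + (y + k)
y+y+2k≡[y+k]+[y+k] = ℕ-solve-∀

alternations-+1 : ∀ W x b → ∣ alternations W (x + 1) b - alternations W x b ∣ ≤ 2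
alternations-+1 zero    x b = z≤n
alternations-+1 (suc W) x b with parity x
... | even y = begin
  ∣ alternations (suc W) (y + y + 1) b - alternations (suc W) (y + y) b ∣
    ≡⟨ cong₂ ∣_-_∣ (trans (cong (λ t → alternations (suc W) t b) (ℕ.+-comm (y + y) 1))
                          (alternations-odd W y b))
                   (alternations-even W y b) ⟩
  ∣ boolToℕ (not b) + alternations W y true - (boolToℕ b + alternations W y false) ∣
    ≤⟨ ∣m+o-n+p∣≤∣m-n∣+∣o-p∣ (boolToℕ (not b)) (boolToℕ b) _ _ ⟩
  ∣ boolToℕ (not b) - boolToℕ b ∣ + ∣ alternations W y true - alternations W y false ∣
    ≤⟨ ℕ.+-mono-≤ (∣not-b-b∣≤1 b) (alternations-flip W y) ⟩
  2 ∎
  where open ℕ.≤-Reasoning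
... | odd y = begin
  ∣ alternations (suc W) (suc (y + y) + 1) b - alternations (suc W) (suc (y + y)) b ∣
    ≡⟨ cong₂ ∣_-_∣ (trans (cong (λ t → alternations (suc W) t b) (ℕ.+-comm (suc (y + y)) 1))
                          (alternations-2+y+y W y b))
                   (alternations-odd W y b) ⟩
  ∣ boolToℕ b + alternations W (suc y) false - (boolToℕ (not b) + alternations W y true) ∣
    ≤⟨ ∣m+o-n+p∣≤∣m-n∣+∣o-p∣ (boolToℕ b) (boolToℕ (not b)) _ _ ⟩
  ∣ boolToℕ b - boolToℕ (not b) ∣ + ∣ alternations W (suc y) false - alternations W y true ∣
    ≤⟨ ℕ.+-mono-≤ (subst (_≤ 1) (ℕ.∣-∣-comm (boolToℕ (not b)) _) (∣not-b-b∣≤1 b)) (alternations-suc W y) ⟩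
  2 ∎
  where open ℕ.≤-Reasoning

alternations-+2^ : ∀ W a x b → ∣ alternations W (x + 2 ^ a) b - alternations W x b ∣ ≤ 2
alternations-+2^ W       zero    x b = alternations-+1 W x b
alternations-+2^ zero    (suc a) x b = z≤n
alternations-+2^ (suc W) (suc a) x b with parity x
... | even y = begin
  ∣ alternations (suc W) (y + y + 2 * k) b - alternations (suc W) (y + y) b ∣
    ≡⟨ cong₂ ∣_-_∣ (trans (cong (λ t → alternations (suc W) t b) (y+y+2k≡[y+k]+[y+k] y k))
                          (alternations-even W (y + k) b))
                   (alternations-even W y b) ⟩
  ∣ boolToℕ b + alternations W (y + k) false - (boolToℕ b + alternations W y false) ∣
    ≡⟨ ℕ.∣m+n-m+o∣≡∣n-o∣ (boolToℕ b) _ _ ⟩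
  ∣ alternations W (y + k) false - alternations W y false ∣
    ≤⟨ alternations-+2^ W a y false ⟩
  2 ∎
  where open ℕ.≤-Reasoning
        k = 2 ^ a
... | odd y = begin
  ∣ alternations (suc W) (suc (y + y) + 2 * k) b - alternations (suc W) (suc (y + y)) b ∣
    ≡⟨ cong₂ ∣_-_∣ (trans (cong (λ t → alternations (suc W) (suc t) b) (y+y+2k≡[y+k]+[y+k] y k))
                          (alternations-odd W (y + k) b))
                   (alternations-odd W y b) ⟩
  ∣ boolToℕ (not b) + alternations W (y + k) true - (boolToℕ (not b) + alternations W y true) ∣
    ≡⟨ ℕ.∣m+n-m+o∣≡∣n-o∣ (boolToℕ (not b)) _ _ ⟩
  ∣ alternations W (y + k) true - alternations W y true ∣
    ≤⟨ alternations-+2^ W a y true ⟩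
  2 ∎
  where open ℕ.≤-Reasoning
        k = 2 ^ a

x-y≡z+k⇒x-[y+k]≡z : ∀ x y k z → x -ℤ y ≡ z +ℤ k → x -ℤ (y +ℤ k) ≡ z
x-y≡z+k⇒x-[y+k]≡z x y k z eq = trans (assoc x y k) (trans (cong (_-ℤ k) eq) (cancel z k))
  where
  assoc : ∀ x y k → x -ℤ (y +ℤ k) ≡ (x -ℤ y) -ℤ k
  assoc = solve-∀
  cancel : ∀ z k → (z +ℤ k) -ℤ k ≡ z
  cancel = solve-∀

x-y≡z-k⇒[x+k]-y≡z : ∀ x y k z → x -ℤ y ≡ z -ℤ k → (x +ℤ k) -ℤ y ≡ z
x-y≡z-k⇒[x+k]-y≡z x y k z eq = trans (assoc x y k) (trans (cong (_+ℤ k) eq) (cancel z k))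
  where
  assoc : ∀ x y k → (x +ℤ k) -ℤ y ≡ (x -ℤ y) +ℤ k
  assoc = solve-∀
  cancel : ∀ z k → (z -ℤ k) +ℤ k ≡ z
  cancel = solve-∀

alternations-lipschitz : ∀ W b {w z} → Pow2Sum w z → ∀ x y → + x -ℤ + y ≡ z →
                         ∣ alternations W x b - alternations W y b ∣ ≤ 2 * w
alternations-lipschitz W b {w} [] x y x-y≡0
  rewrite ℤ.+-injective (ℤ.i-j≡0⇒i≡j (+ x) (+ y) x-y≡0) =
  subst (_≤ 2 * w) (sym (ℕ.∣n-n∣≡0 (alternations W y b))) z≤n
alternations-lipschitz W b {suc w} (plus {x = z} a s) x y x-y≡z+k = begin
  ∣ A x - A y ∣                   ≤⟨ ℕ.∣-∣-triangle (A x) (A (y + k)) (A y) ⟩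
  ∣ A x - A (y + k) ∣ + ∣ A (y + k) - A y ∣
    ≤⟨ ℕ.+-mono-≤ (alternations-lipschitz W b s x (y + k) x-[y+k]≡z) (alternations-+2^ W a y b) ⟩
  2 * w + 2                      ≡⟨ ℕ.+-comm (2 * w) 2 ⟨ trans ⟩ sym (ℕ.*-suc 2 w) ⟩
  2 * suc w                      ∎
  where
  open ℕ.≤-Reasoning
  A = λ t → alternations W t b
  k = 2 ^ a
  x-[y+k]≡z : + x -ℤ + (y + k) ≡ z
  x-[y+k]≡z = x-y≡z+k⇒x-[y+k]≡z (+ x) (+ y) (+ k) z x-y≡z+k
alternations-lipschitz W b {suc w} (minus {x = z} a s) x y x-y≡z-k = begin
  ∣ A x - A y ∣                   ≤⟨ ℕ.∣-∣-triangle (A x) (A (x + k)) (A y) ⟩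
  ∣ A x - A (x + k) ∣ + ∣ A (x + k) - A y ∣
    ≤⟨ ℕ.+-mono-≤ (ℕ.≤-trans (ℕ.≤-reflexive (ℕ.∣-∣-comm (A x) _)) (alternations-+2^ W a x b))
                  (alternations-lipschitz W b s (x + k) y [x+k]-y≡z) ⟩
  2 + 2 * w                      ≡⟨ sym (ℕ.*-suc 2 w) ⟩
  2 * suc w                      ∎
  where
  open ℕ.≤-Reasoning
  A = λ t → alternations W t b
  k = 2 ^ a
  [x+k]-y≡z : + (x + k) -ℤ + y ≡ z
  [x+k]-y≡z = x-y≡z-k⇒[x+k]-y≡z (+ x) (+ y) (+ k) z x-y≡z-k

alternations≤2*weight : ∀ W {w x} → Pow2Sum w (+ x) → alternations W x false ≤ 2 * w
alternations≤2*weight W {w} {x} s = begin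
  alternations W x false
    ≡⟨ sym (ℕ.∣-∣-identityʳ _) ⟩
  ∣ alternations W x false - 0 ∣
    ≡⟨ cong (λ t → ∣ alternations W x false - t ∣) (sym (alternations-zero W)) ⟩
  ∣ alternations W x false - alternations W 0 false ∣
    ≤⟨ alternations-lipschitz W false s x 0 (ℤ.+-identityʳ (+ x)) ⟩
  2 * w ∎
  where open ℕ.≤-Reasoning

alternations-split : ∀ W {u v ru rv w} → Pow2Sum ru (+ u) → Pow2Sum rv (+ v) → Pow2Sum w (+ u -ℤ + v) →
                     alternations W (u + v) false ≤ ru + rv + 2 * w
alternations-split W {u} {v} {ru} {rv} {w} su sv sd = ℕ.*-cancelˡ-≤ 2 (begin
  2 * A                              ≡⟨ cong (_+_ A) (ℕ.+-identityʳ A) ⟩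
  A + A                              ≤⟨ ℕ.+-mono-≤ (alternations≤2*weight W viaU) (alternations≤2*weight W viaV) ⟩
  2 * (ru + w) + 2 * (rv + w)        ≡⟨ collect ru rv w ⟩
  2 * (ru + rv + 2 * w)              ∎)
  where
  open ℕ.≤-Reasoning
  collect : ∀ ru rv w → 2 * (ru + w) + 2 * (rv + w) ≡ 2 * (ru + rv + 2 * w)
  collect = ℕ-solve-∀
  A = alternations W (u + v) false
  viaU : Pow2Sum (ru + w) (+ (u + v))
  viaU = subst (Pow2Sum _) (u+v≡2u-[u-v] (+ u) (+ v)) (pow2Sum-- (pow2Sum-double su) sd)
    where u+v≡2u-[u-v] : ∀ u v → + 2 *ℤ u -ℤ (u -ℤ v) ≡ u +ℤ v
          u+v≡2u-[u-v] = solve-∀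
  viaV : Pow2Sum (rv + w) (+ (u + v))
  viaV = subst (Pow2Sum _) (u+v≡2v+[u-v] (+ u) (+ v)) (pow2Sum-+ (pow2Sum-double sv) sd)
    where u+v≡2v+[u-v] : ∀ u v → + 2 *ℤ v +ℤ (u -ℤ v) ≡ u +ℤ v
          u+v≡2v+[u-v] = solve-∀

-- repunit₄ m = 1 + 4 + ⋯ + 4^(m-1), whose binary expansion 01…0101 has 2m alternations.
repunit₄ : ℕ → ℕ
repunit₄ zero    = 0
repunit₄ (suc m) = suc (4 * repunit₄ m)

repunit₄-suc : ∀ m → repunit₄ (suc m) ≡ repunit₄ m + 4 ^ m
repunit₄-suc zero    = refl
repunit₄-suc (suc m) = begin-equality
  suc (4 * repunit₄ (suc m))         ≡⟨ cong (suc ∘ (4 *_)) (repunit₄-suc m) ⟩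
  suc (4 * (repunit₄ m + 4 ^ m))     ≡⟨ cong suc (ℕ.*-distribˡ-+ 4 (repunit₄ m) (4 ^ m)) ⟩
  suc (4 * repunit₄ m) + 4 ^ suc m   ∎
  where open ℕ.≤-Reasoning

repunit₄-mono-≤ : ∀ {m M} → m ≤ M → repunit₄ m ≤ repunit₄ M
repunit₄-mono-≤ z≤n       = z≤n
repunit₄-mono-≤ (s≤s m≤M) = s≤s (ℕ.*-monoʳ-≤ 4 (repunit₄-mono-≤ m≤M))

m≤repunit₄ : ∀ m → m ≤ repunit₄ m
m≤repunit₄ zero    = z≤n
m≤repunit₄ (suc m) = s≤s (ℕ.≤-trans (m≤repunit₄ m) (ℕ.m≤n*m (repunit₄ m) 4))

repunit₄<4^ : ∀ m → repunit₄ m < 4 ^ m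
repunit₄<4^ zero    = s≤s z≤n
repunit₄<4^ (suc m) = begin
  suc (suc (4 * repunit₄ m))       ≤⟨ ℕ.m≤n+m _ 2 ⟩
  2 + suc (suc (4 * repunit₄ m))   ≡⟨ *4 (repunit₄ m) ⟩
  4 * suc (repunit₄ m)             ≤⟨ ℕ.*-monoʳ-≤ 4 (repunit₄<4^ m) ⟩
  4 ^ suc m                        ∎
  where
  open ℕ.≤-Reasoning
  *4 : ∀ x → 2 + suc (suc (4 * x)) ≡ 4 * suc x
  *4 = ℕ-solve-∀

⌊log₂repunit₄⌋ : ∀ m → ⌊log₂ repunit₄ m ⌋ ≤ 2 * m
⌊log₂repunit₄⌋ m = begin
  ⌊log₂ repunit₄ m ⌋    ≤⟨ ⌊log₂⌋-mono-≤ (ℕ.<⇒≤ (repunit₄<4^ m)) ⟩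
  ⌊log₂ 4 ^ m ⌋         ≡⟨ cong ⌊log₂_⌋ (ℕ.^-*-assoc 2 2 m) ⟩
  ⌊log₂ 2 ^ (2 * m) ⌋   ≡⟨ ⌊log₂[2^n]⌋≡n (2 * m) ⟩
  2 * m                 ∎
  where open ℕ.≤-Reasoning

[1+4x]/2≤2x : ∀ x → suc (4 * x) / 2 ≤ 2 * x
[1+4x]/2≤2x x = s≤s⁻¹ (m<n*o⇒m/o<n (subst (suc (4 * x) <_) (double x) (ℕ.n<1+n _)))
  where double : ∀ x → suc (suc (4 * x)) ≡ suc (2 * x) * 2
        double = ℕ-solve-∀

4*z≡[z+z]+[z+z] : ∀ z → 4 * z ≡ (z + z) + (z + z)
4*z≡[z+z]+[z+z] = ℕ-solve-∀

alternations-4* : ∀ W z → alternations (2 + W) (4 * z) false ≡ alternations W z false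
alternations-4* W z = begin-equality
  alternations (2 + W) (4 * z) false
    ≡⟨ cong (λ t → alternations (2 + W) t false) (4*z≡[z+z]+[z+z] z) ⟩
  alternations (2 + W) ((z + z) + (z + z)) false
    ≡⟨ alternations-even (suc W) (z + z) false ⟩
  alternations (1 + W) (z + z) false
    ≡⟨ alternations-even W z false ⟩
  alternations W z false ∎
  where open ℕ.≤-Reasoning

alternations-1+4* : ∀ W z → alternations (2 + W) (suc (4 * z)) false ≡ 2 + alternations W z false
alternations-1+4* W z = begin-equality
  alternations (2 + W) (suc (4 * z)) false
    ≡⟨ cong (λ t → alternations (2 + W) (suc t) false) (4*z≡[z+z]+[z+z] z) ⟩
  alternations (2 + W) (suc ((z + z) + (z + z))) false
    ≡⟨ alternations-odd (suc W) (z + z) false ⟩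
  1 + alternations (1 + W) (z + z) true
    ≡⟨ cong suc (alternations-even W z true) ⟩
  2 + alternations W z false ∎
  where open ℕ.≤-Reasoning

alternations-repunit₄ : ∀ m → alternations (2 * m) (repunit₄ m) false ≡ 2 * m
alternations-repunit₄ zero    = refl
alternations-repunit₄ (suc m) = begin-equality
  alternations (2 * suc m) (repunit₄ (suc m)) false
    ≡⟨ cong (λ W → alternations W (repunit₄ (suc m)) false) (ℕ.*-suc 2 m) ⟩
  alternations (2 + 2 * m) (suc (4 * repunit₄ m)) false
    ≡⟨ alternations-1+4* (2 * m) (repunit₄ m) ⟩
  2 + alternations (2 * m) (repunit₄ m) false
    ≡⟨ cong (_+_ 2) (alternations-repunit₄ m) ⟩
  2 + 2 * m
    ≡⟨ sym (ℕ.*-suc 2 m) ⟩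
  2 * suc m ∎
  where open ℕ.≤-Reasoning

4*repunit₄-split-weight : ∀ m {u v ru rv w} → u + v ≡ 4 * repunit₄ m → ru + rv ≡ m →
                   Pow2Sum ru (+ u) → Pow2Sum rv (+ v) → Pow2Sum w (+ u -ℤ + v) → m ≤ 2 * w
4*repunit₄-split-weight m {u} {v} {ru} {rv} {w} u+v≡ ru+rv≡m su sv sd = ℕ.+-cancelˡ-≤ m m (2 * w) (begin
  m + m                                           ≡⟨ cong (_+_ m) (sym (ℕ.+-identityʳ m)) ⟩
  2 * m                                           ≡⟨ sym (alternations-repunit₄ m) ⟩
  alternations (2 * m) (repunit₄ m) false         ≡⟨ sym (alternations-4* (2 * m) (repunit₄ m)) ⟩
  alternations (2 + 2 * m) (4 * repunit₄ m) false ≡⟨ cong (λ t → alternations (2 + 2 * m) t false) (sym u+v≡) ⟩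
  alternations (2 + 2 * m) (u + v) false          ≤⟨ alternations-split (2 + 2 * m) su sv sd ⟩
  ru + rv + 2 * w                                 ≡⟨ cong (_+ 2 * w) ru+rv≡m ⟩
  m + 2 * w                                       ∎)
  where open ℕ.≤-Reasoning

-- Covers of trees given by a parent function

count : (ℕ → Bool) → ℕ → ℕ → ℕ
count X q zero    = 0
count X q (suc s) = boolToℕ (X q) + count X (suc q) s

count-+ : ∀ X q s t → count X q (s + t) ≡ count X q s + count X (q + s) t
count-+ X q zero    t = cong (λ q′ → count X q′ t) (sym (ℕ.+-identityʳ q))
count-+ X q (suc s) t = begin-equality
  boolToℕ (X q) + count X (suc q) (s + t)
    ≡⟨ cong (_+_ (boolToℕ (X q))) (count-+ X (suc q) s t) ⟩
  boolToℕ (X q) + (count X (suc q) s + count X (suc q + s) t)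
    ≡⟨ sym (ℕ.+-assoc (boolToℕ (X q)) _ _) ⟩
  count X q (suc s) + count X (suc q + s) t
    ≡⟨ cong (λ q′ → count X q (suc s) + count X q′ t) (sym (ℕ.+-suc q s)) ⟩
  count X q (suc s) + count X (q + suc s) t ∎
  where open ℕ.≤-Reasoning

count-suc : ∀ X q s → count X (suc q) s ≡ count (X ∘ suc) q s
count-suc X q zero    = refl
count-suc X q (suc s) = cong (_+_ (boolToℕ (X (suc q)))) (count-suc X (suc q) s)

indicator : ∀ {n} → Subset n → ℕ → Bool
indicator []      _       = false
indicator (b ∷ V) zero    = b
indicator (b ∷ V) (suc i) = indicator V i

indicator-∈ : ∀ {n} {V : Subset n} {i} → i ∈ V → indicator V (toℕ i) ≡ true
indicator-∈ here      = refl
indicator-∈ (there p) = indicator-∈ p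

∣V∣≡count : ∀ {n} (V : Subset n) → ∣ V ∣ ≡ count (indicator V) 0 n
∣V∣≡count []                  = refl
∣V∣≡count {suc n} (true ∷ V)  = cong suc (trans (∣V∣≡count V) (sym (count-suc (indicator (true ∷ V)) 0 n)))
∣V∣≡count {suc n} (false ∷ V) = trans (∣V∣≡count V) (sym (count-suc (indicator (false ∷ V)) 0 n))

Covered : (ℕ → Bool) → (ℕ → Bool) → ℕ → ℕ → Set
Covered X Y u v = (X u ≡ true × X v ≡ true) ⊎ (Y u ≡ true × Y v ≡ true)

CoversParent : ℕ → (ℕ → ℕ) → (ℕ → Bool) → (ℕ → Bool) → Set
CoversParent n par X Y = ∀ {c} → 0 < c → c < n → Covered X Y (par c) c

coversParent-swap : ∀ {n par X Y} → CoversParent n par X Y → CoversParent n par Y X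
coversParent-swap cover 0<c c<n = Sum.swap (cover 0<c c<n)

module ParentTree (parent : ℕ → ℕ) (parent-< : ∀ {u} → 0 < u → parent u < u) where

  IsChild : ℕ → ℕ → Set
  IsChild p c = c ≢ 0 × parent c ≡ p

  isChild? : ∀ p c → Dec (IsChild p c)
  isChild? p c = ¬? (c ≟ 0) ×-dec (parent c ≟ p)

  child-< : ∀ {p c} → IsChild p c → p < c
  child-< {c = zero}  (c≢0 , _)    = contradiction refl c≢0
  child-< {c = suc c} (_ , refl)   = parent-< (s≤s z≤n)

  same-parent : ∀ {p q c} → IsChild p c → IsChild q c → p ≡ q
  same-parent (_ , refl) (_ , refl) = refl

  Adjacent : ℕ → ℕ → Set
  Adjacent u v = IsChild u v ⊎ IsChild v u

  adjacent? : ∀ u v → Dec (Adjacent u v)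
  adjacent? u v = isChild? u v ⊎-dec isChild? v u

  does⇒witness : ∀ {P : Set} (d : Dec P) → does d ≡ true → P
  does⇒witness (yes p) _ = p

  not-adjacent-self : ∀ u → does (adjacent? u u) ≡ false
  not-adjacent-self u = dec-false (adjacent? u u) [ irrefl , irrefl ]
    where irrefl = λ c → ℕ.<-irrefl refl (child-< c)

  module _ (n : ℕ) where

    parentGraph : Graph (suc n)
    parentGraph = record
      { adj      = λ u v → does (adjacent? (toℕ u) (toℕ v))
      ; sym      = λ u v → Bool.∨-comm (does (isChild? (toℕ u) (toℕ v))) _
      ; loopless = λ u → not-adjacent-self (toℕ u)
      }

    IsChildᶠ : Fin (suc n) → Fin (suc n) → Set
    IsChildᶠ u v = IsChild (toℕ u) (toℕ v)

    parentᶠ : (u : Fin (suc n)) → 0 < toℕ u → Fin (suc n)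
    parentᶠ u 0<u = fromℕ< (ℕ.<-trans (parent-< 0<u) (toℕ<n u))

    pathToRoot : ∀ f (u : Fin (suc n)) → toℕ u < f → Star (Edge parentGraph) u Fin.zero
    pathToRoot f       Fin.zero    _         = ε
    pathToRoot (suc f) u@(Fin.suc i) (s≤s u≤f) = toParent ◅ pathToRoot f p (ℕ.<-≤-trans p<u u≤f)
      where
      p = parentᶠ u (s≤s z≤n)
      p<u : toℕ p < toℕ u
      p<u = subst (_< toℕ u) (sym (toℕ-fromℕ< _)) (parent-< (s≤s z≤n))
      toParent : Edge parentGraph u p
      toParent = dec-true (adjacent? _ _) (inj₂ ((λ ()) , sym (toℕ-fromℕ< _)))

    edge⇒adjacent : ∀ {u v} → Edge parentGraph u v → Adjacent (toℕ u) (toℕ v)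
    edge⇒adjacent = does⇒witness (adjacent? _ _)

    parentGraph-connected : Connected parentGraph
    parentGraph-connected u v =
      pathToRoot _ u (toℕ<n u) ◅◅ reverse (λ {a} {b} → trans (Graph.sym parentGraph b a)) (pathToRoot _ v (toℕ<n v))

    last : Fin (suc n) → List (Fin (suc n)) → Fin (suc n)
    last v []       = v
    last v (w ∷ ws) = last w ws

    LastStep : (Fin (suc n) → Fin (suc n) → Set) → Fin (suc n) → Fin (suc n) → List (Fin (suc n)) → Set
    LastStep R u v []       = R u v
    LastStep R u v (w ∷ ws) = LastStep R v w ws

    ascending : ∀ u v ws → Chain parentGraph (u ∷ v ∷ ws) → Unique (u ∷ v ∷ ws) → IsChildᶠ u v →
                LastStep IsChildᶠ u v ws × toℕ u < toℕ (last v ws)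
    ascending u v []       _                      _                       u→v = u→v , child-< u→v
    ascending u v (w ∷ ws) (chain-∷ _ _ _ _ vw-chain) ((_ ∷ u≢w ∷ _) ∷ unique) u→v with vw-chain
    ... | chain-∷ _ _ _ vw _ with edge⇒adjacent vw
    ...   | inj₁ v→w = Prod.map₂ (ℕ.<-trans (child-< u→v)) (ascending v w ws vw-chain unique v→w)
    ...   | inj₂ w→v = contradiction (toℕ-injective (same-parent u→v w→v)) u≢w

    descending : ∀ u v ws → Chain parentGraph (u ∷ v ∷ ws) → Unique (u ∷ v ∷ ws) →
                 ¬ LastStep IsChildᶠ u v ws → toℕ (last v ws) < toℕ u
    descending u v []       (chain-∷ _ _ _ uv _) _ ¬u→v = [ flip contradiction ¬u→v , child-< ] (edge⇒adjacent uv)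
    descending u v (w ∷ ws) chain@(chain-∷ _ _ _ uv vw-chain) unique@(_ ∷ unique′) ¬last with edge⇒adjacent uv
    ... | inj₁ u→v = contradiction (proj₁ (ascending u v (w ∷ ws) chain unique u→v)) ¬last
    ... | inj₂ v→u = ℕ.<-trans (descending v w ws vw-chain unique′ ¬last) (child-< v→u)

    last-++ : ∀ v ws y → last v (ws ++ y ∷ []) ≡ y
    last-++ v []       y = refl
    last-++ v (w ∷ ws) y = last-++ w ws y

    lastStep-++ : ∀ {R} u v ws y → LastStep R u v (ws ++ y ∷ []) → R (last v ws) y
    lastStep-++ u v []       y r = r
    lastStep-++ u v (w ∷ ws) y r = lastStep-++ v w ws y r

    all-last : ∀ {P : Fin (suc n) → Set} v ws → All P (v ∷ ws) → P (last v ws)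
    all-last v []       (p ∷ _)  = p
    all-last v (w ∷ ws) (_ ∷ ps) = all-last w ws ps

    -- A walk without repeated vertices that steps down to a child can never step back up, as that
    -- would revisit the parent; so along a cycle the vertex numbers would increase or decrease
    -- all the way round.
    parentGraph-acyclic : Acyclic parentGraph
    parentGraph-acyclic (x , [] , y , () , _)
    parentGraph-acyclic (x , z ∷ zs , y , _ , unique@(_ ∷ z∉ ∷ _) , chain@(chain-∷ _ _ _ xz _) , yx)
      with edge⇒adjacent yx
    ... | inj₁ y→x with edge⇒adjacent xz
    ...   | inj₁ x→z = ℕ.<-asym (child-< y→x) (subst (λ t → toℕ x < toℕ t) (last-++ z zs y)
                                                       (proj₂ (ascending x z (zs ++ y ∷ []) chain unique x→z)))
    ...   | inj₂ z→x = All.head (All.++⁻ʳ zs z∉) (toℕ-injective (same-parent z→x y→x))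
    parentGraph-acyclic (x , z ∷ zs , y , _ , unique@(x∉ ∷ _) , chain , yx) | inj₂ x→y =
      ℕ.<-asym (child-< x→y) (subst (λ t → toℕ t < toℕ x) (last-++ z zs y)
                                     (descending x z (zs ++ y ∷ []) chain unique ¬lastUp))
      where
      ¬lastUp : ¬ LastStep IsChildᶠ x z (zs ++ y ∷ [])
      ¬lastUp last→y =
        all-last z zs (All.++⁻ˡ (z ∷ zs) x∉) (toℕ-injective (same-parent x→y (lastStep-++ x z zs y last→y)))

    parentTree : Tree (suc n)
    parentTree = record { graph = parentGraph ; connected = parentGraph-connected ; acyclic = parentGraph-acyclic }

    covers2⇒coversParent : ∀ {V₁ V₂} → Covers2 parentGraph V₁ V₂ →
                           CoversParent (suc n) parent (indicator V₁) (indicator V₂)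
    covers2⇒coversParent {V₁} {V₂} cover {c} 0<c c<n =
      subst₂ (Covered (indicator V₁) (indicator V₂)) (toℕ-fromℕ< p<n) (toℕ-fromℕ< c<n)
        (Sum.map (Prod.map indicator-∈ indicator-∈) (Prod.map indicator-∈ indicator-∈)
                 (cover (fromℕ< p<n) (fromℕ< c<n) edge))
      where
      p<n : parent c < suc n
      p<n = ℕ.<-trans (parent-< 0<c) c<n
      edge : Edge parentGraph (fromℕ< p<n) (fromℕ< c<n)
      edge = dec-true (adjacent? _ _)
        (inj₁ (subst (_≢ 0) (sym (toℕ-fromℕ< c<n)) (ℕ.>⇒≢ 0<c) ,
               trans (cong parent (toℕ-fromℕ< c<n)) (sym (toℕ-fromℕ< p<n))))

-- The family

data Shape : Set where
  leaf : Shape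
  node : Shape → Shape → Shape

size : Shape → ℕ
size leaf       = 0
size (node l r) = suc (size l + size r)

perfect : ℕ → Shape
perfect zero    = leaf
perfect (suc h) = node (perfect h) (perfect h)

size-perfect : ∀ h → suc (size (perfect h)) ≡ 2 ^ h
size-perfect zero    = refl
size-perfect (suc h) = begin-equality
  suc (suc (size (perfect h) + size (perfect h)))  ≡⟨ cong suc (sym (ℕ.+-suc (size (perfect h)) _)) ⟩
  suc (size (perfect h)) + suc (size (perfect h))  ≡⟨ cong₂ _+_ (size-perfect h) (size-perfect h) ⟩
  2 ^ h + 2 ^ h                                    ≡⟨ cong (_+_ (2 ^ h)) (sym (ℕ.+-identityʳ (2 ^ h))) ⟩
  2 ^ suc h                                        ∎
  where open ℕ.≤-Reasoning

-- The parent of u when the vertices of the shape are numbered in preorder from q and the root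
-- hangs below p.
parentIn : Shape → ℕ → ℕ → ℕ → ℕ
parentIn leaf       q p u = p
parentIn (node l r) q p u with u ≟ q | u <? suc q + size l
... | yes _ | _     = p
... | no _  | yes _ = parentIn l (suc q) q u
... | no _  | no _  = parentIn r (suc q + size l) q u

parentIn-< : ∀ t {q p u} → q ≤ u → p < q → parentIn t q p u < u
parentIn-< leaf       q≤u p<q = ℕ.<-≤-trans p<q q≤u
parentIn-< (node l r) {q} {p} {u} q≤u p<q with u ≟ q | u <? suc q + size l
... | yes refl | _      = p<q
... | no u≢q   | yes _  = parentIn-< l (ℕ.≤∧≢⇒< q≤u (u≢q ∘ sym)) (ℕ.n<1+n q)
... | no _     | no u≮ = parentIn-< r (ℕ.≮⇒≥ u≮) (s≤s (ℕ.m≤m+n q (size l)))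

parentIn-root : ∀ l r {q p} → parentIn (node l r) q p q ≡ p
parentIn-root l r {q} with q ≟ q
... | yes _  = refl
... | no q≢q = contradiction refl q≢q

parentIn-left : ∀ l r {q p u} → q < u → u < suc q + size l → parentIn (node l r) q p u ≡ parentIn l (suc q) q u
parentIn-left l r {q} {p} {u} q<u u< with u ≟ q | u <? suc q + size l
... | yes refl | _      = contradiction q<u (ℕ.<-irrefl refl)
... | no _     | yes _  = refl
... | no _     | no u≮ = contradiction u< u≮

parentIn-right : ∀ l r {q p u} → suc q + size l ≤ u → parentIn (node l r) q p u ≡ parentIn r (suc q + size l) q u
parentIn-right l r {q} {p} {u} ≤u with u ≟ q | u <? suc q + size l
... | yes refl | _     = contradiction (ℕ.≤-trans (s≤s (ℕ.m≤m+n q (size l))) ≤u) (ℕ.<-irrefl refl)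
... | no _     | yes u< = contradiction ≤u (ℕ.<⇒≱ u<)
... | no _     | no _   = refl

data Embeds (par : ℕ → ℕ) : Shape → ℕ → ℕ → Set where
  leaf : ∀ {q p} → Embeds par leaf q p
  node : ∀ {l r q p} → par q ≡ p → Embeds par l (suc q) q → Embeds par r (suc q + size l) q →
         Embeds par (node l r) q p

embeds-root : ∀ {par l r q p} → Embeds par (node l r) q p → par q ≡ p
embeds-root (node par≡p _ _) = par≡p

q+size≡ : ∀ q l r → q + size (node l r) ≡ suc q + size l + size r
q+size≡ q l r = trans (ℕ.+-suc q (size l + size r)) (cong suc (sym (ℕ.+-assoc q (size l) (size r))))

embeds-parentIn : ∀ t {par q p} → (∀ u → q ≤ u → u < q + size t → par u ≡ parentIn t q p u) → Embeds par t q p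
embeds-parentIn leaf       _ = leaf
embeds-parentIn (node l r) {par} {q} {p} agree =
  node (trans (agree q ℕ.≤-refl (ℕ.<-≤-trans (s≤s (ℕ.m≤m+n q (size l))) leftEnd≤)) (parentIn-root l r {q}))
       (embeds-parentIn l λ u q<u u< →
          trans (agree u (ℕ.<⇒≤ q<u) (ℕ.<-≤-trans u< leftEnd≤)) (parentIn-left l r {q} q<u u<))
       (embeds-parentIn r λ u ≤u u< →
          trans (agree u (ℕ.≤-trans q≤leftEnd ≤u) (ℕ.<-≤-trans u< end≡)) (parentIn-right l r {q} ≤u))
  where
  q≤leftEnd : q ≤ suc q + size l
  q≤leftEnd = ℕ.≤-trans (ℕ.m≤m+n q (size l)) (ℕ.n≤1+n _)
  end≡ : suc q + size l + size r ≤ q + size (node l r)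
  end≡ = ℕ.≤-reflexive (sym (q+size≡ q l r))
  leftEnd≤ : suc q + size l ≤ q + size (node l r)
  leftEnd≤ = ℕ.≤-trans (ℕ.m≤m+n _ (size r)) end≡

block : ℕ → Shape
block j = node (perfect (2 * suc j)) leaf

size-block : ∀ j → size (block j) ≡ 4 ^ suc j
size-block j = begin-equality
  suc (size (perfect (2 * suc j)) + 0)  ≡⟨ cong suc (ℕ.+-identityʳ _) ⟩
  suc (size (perfect (2 * suc j)))      ≡⟨ size-perfect (2 * suc j) ⟩
  2 ^ (2 * suc j)                       ≡⟨ sym (ℕ.^-*-assoc 2 2 (suc j)) ⟩
  4 ^ suc j                             ∎
  where open ℕ.≤-Reasoning

-- Vertex 0 is the root; block j occupies the vertices from repunit₄ (suc j) to
-- repunit₄ (suc (suc j)) − 1, and its top hangs below the root.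
familyParent : ℕ → ℕ → ℕ
familyParent zero    u = 0
familyParent (suc m) u with u <? repunit₄ (suc m)
... | yes _ = familyParent m u
... | no _  = parentIn (block m) (repunit₄ (suc m)) 0 u

familyParent-< : ∀ m {u} → 0 < u → familyParent m u < u
familyParent-< zero    0<u = 0<u
familyParent-< (suc m) {u} 0<u with u <? repunit₄ (suc m)
... | yes _ = familyParent-< m 0<u
... | no u≮ = parentIn-< (block m) (ℕ.≮⇒≥ u≮) (s≤s z≤n)

familyParent-below : ∀ {m M u} → m ≤′ M → u < repunit₄ (suc m) → familyParent M u ≡ familyParent m u
familyParent-below ≤′-refl _ = refl
familyParent-below {m} {suc M} {u} (≤′-step m≤′M) u< with u <? repunit₄ (suc M)
... | yes _ = familyParent-below m≤′M u<
... | no u≮ = contradiction (ℕ.<-≤-trans u< (repunit₄-mono-≤ (s≤s (ℕ.≤′⇒≤ m≤′M)))) u≮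

familyParent-block : ∀ {j u} → repunit₄ (suc j) ≤ u →
                     familyParent (suc j) u ≡ parentIn (block j) (repunit₄ (suc j)) 0 u
familyParent-block {j} {u} ≤u with u <? repunit₄ (suc j)
... | yes u< = contradiction ≤u (ℕ.<⇒≱ u<)
... | no _   = refl

block-embeds : ∀ {j M} → j < M → Embeds (familyParent M) (block j) (repunit₄ (suc j)) 0
block-embeds {j} {M} j<M = embeds-parentIn (block j) agree
  where
  end≡ : repunit₄ (suc j) + size (block j) ≡ repunit₄ (suc (suc j))
  end≡ = trans (cong (_+_ (repunit₄ (suc j))) (size-block j)) (sym (repunit₄-suc (suc j)))
  agree : ∀ u → repunit₄ (suc j) ≤ u → u < repunit₄ (suc j) + size (block j) →
          familyParent M u ≡ parentIn (block j) (repunit₄ (suc j)) 0 u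
  agree u ≤u u< = trans (familyParent-below (ℕ.≤⇒≤′ j<M) (subst (u <_) end≡ u<)) (familyParent-block ≤u)

family : ℕ → Σ ℕ Tree
family k = repunit₄ (suc (suc k)) ,
           ParentTree.parentTree (familyParent (suc k)) (familyParent-< (suc k)) (4 * repunit₄ (suc k))

family-unbounded : ∀ m → ∃[ k ] m ≤ proj₁ (family k)
family-unbounded m = m , ℕ.≤-trans (m≤repunit₄ m) (repunit₄-mono-≤ (ℕ.m≤n+m m 2))

-- Covers of subtrees

-- For a subtree of size s whose root lies in X, with a of its vertices in X and b in Y.
record Lopsided (a b s : ℕ) : Set where
  constructor lopsided
  field
    shared  : ℕ
    counts  : a + b ≡ s + shared
    defect  : Pow2Sum (5 * shared) (+ s +ℤ + b -ℤ + a)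

-- The subtree of a child is lopsided towards the side that covers the edge to its parent,
-- whose membership in Y is y.
ChildLopsided : ℕ → ℕ → ℕ → Bool → Set
ChildLopsided a b s y = Lopsided a b s ⊎ (Lopsided b a s × y ≡ true)

-- A child on the Y side contributes 2s minus its own defect; 2s = 2^(h+1) − 2 costs two powers,
-- paid for by the parent, which is then shared.
childLopsided-defect : ∀ {a b s y} → Pow2Sum 2 (+ (2 * s)) → ChildLopsided a b s y →
                       Σ[ c ∈ ℕ ] (a + b ≡ s + c × Pow2Sum (5 * c + 2 * boolToℕ y) (+ s +ℤ + b -ℤ + a))
childLopsided-defect _ (inj₁ (lopsided c a+b≡s+c defect)) = c , a+b≡s+c , pow2Sum-mono (ℕ.m≤m+n _ _) defect
childLopsided-defect {a} {b} {s} 2s (inj₂ (lopsided c b+a≡s+c defect , refl)) =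
  c , trans (ℕ.+-comm a b) b+a≡s+c ,
  subst₂ Pow2Sum (ℕ.+-comm 2 (5 * c)) (trans (cong (_-ℤ (+ s +ℤ + a -ℤ + b)) (ℤ.pos-* 2 s)) (reflect (+ s) (+ a) (+ b)))
    (pow2Sum-- 2s defect)
  where reflect : ∀ s a b → + 2 *ℤ s -ℤ (s +ℤ a -ℤ b) ≡ s +ℤ b -ℤ a
        reflect = solve-∀

lopsided-node : ∀ {aL bL aR bR sL sR} y → Pow2Sum 2 (+ (2 * sL)) → Pow2Sum 2 (+ (2 * sR)) →
                ChildLopsided aL bL sL y → ChildLopsided aR bR sR y →
                Lopsided (suc (aL + aR)) (boolToℕ y + (bL + bR)) (suc (sL + sR))
lopsided-node {aL} {bL} {aR} {bR} {sL} {sR} y 2sL 2sR left right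
  with childLopsided-defect {aL} {bL} 2sL left | childLopsided-defect {aR} {bR} 2sR right
... | cL , eL , dL | cR , eR , dR = lopsided
  (β + (cL + cR))
  (trans (regroup aL bL aR bR β) (trans (cong₂ (λ x z → suc (β + (x + z))) eL eR) (sym (regroup sL cL sR cR β))))
  (subst₂ Pow2Sum (weight β cL cR) (defect (+ β) (+ sL) (+ bL) (+ aL) (+ sR) (+ bR) (+ aR))
    (pow2Sum-+ (pow2Sum-ℕ β) (pow2Sum-+ dL dR)))
  where
  β = boolToℕ y
  regroup : ∀ aL bL aR bR β → suc (aL + aR) + (β + (bL + bR)) ≡ suc (β + ((aL + bL) + (aR + bR)))
  regroup = ℕ-solve-∀
  weight : ∀ β cL cR → β + ((5 * cL + 2 * β) + (5 * cR + 2 * β)) ≡ 5 * (β + (cL + cR))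
  weight = ℕ-solve-∀
  defect : ∀ β sL bL aL sR bR aR → β +ℤ ((sL +ℤ bL -ℤ aL) +ℤ (sR +ℤ bR -ℤ aR)) ≡
           (+ 1 +ℤ (sL +ℤ sR)) +ℤ (β +ℤ (bL +ℤ bR)) -ℤ (+ 1 +ℤ (aL +ℤ aR))
  defect = solve-∀

module _ {n : ℕ} {par : ℕ → ℕ} where

  LopsidedAt : Shape → ℕ → Set
  LopsidedAt t q = ∀ {X Y} → CoversParent n par X Y → X q ≡ true →
                   Lopsided (count X q (size t)) (count Y q (size t)) (size t)

  LopsidedShape : Shape → Set
  LopsidedShape t = ∀ {q p} → Embeds par t q p → q + size t ≤ n → LopsidedAt t q

  child-lopsided : ∀ {t q′ q X Y} → LopsidedShape t → Embeds par t q′ q → 0 < q′ → q′ + size t ≤ n →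
                   CoversParent n par X Y → ChildLopsided (count X q′ (size t)) (count Y q′ (size t)) (size t) (Y q)
  child-lopsided _ leaf _ _ _ = inj₁ (lopsided 0 refl [])
  child-lopsided {node _ _} {q′} {q} {X} {Y} lop e@(node par≡q _ _) 0<q′ bound cover
    with subst (λ p → Covered X Y p q′) par≡q (cover 0<q′ (ℕ.<-≤-trans (ℕ.m<m+n q′ (s≤s z≤n)) bound))
  ... | inj₁ (_ , Xq′)  = inj₁ (lop e bound cover Xq′)
  ... | inj₂ (Yq , Yq′) = inj₂ (lop e bound (coversParent-swap cover) Yq′ , Yq)

  node-lopsided : ∀ {l r} → Pow2Sum 2 (+ (2 * size l)) → Pow2Sum 2 (+ (2 * size r)) →
                  LopsidedShape l → LopsidedShape r → LopsidedShape (node l r)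
  node-lopsided {l} {r} 2sL 2sR lopL lopR {q} (node _ el er) bound {X} {Y} cover Xq
    rewrite count-+ X (suc q) (size l) (size r) | count-+ Y (suc q) (size l) (size r) | Xq =
    lopsided-node (Y q) 2sL 2sR (child-lopsided lopL el (s≤s z≤n) boundL cover)
                                (child-lopsided lopR er (s≤s z≤n) boundR cover)
    where
    boundR : suc q + size l + size r ≤ n
    boundR = subst (_≤ n) (q+size≡ q l r) bound
    boundL : suc q + size l ≤ n
    boundL = ℕ.≤-trans (ℕ.m≤m+n _ (size r)) boundR

double-size-perfect : ∀ h → Pow2Sum 2 (+ (2 * size (perfect h)))
double-size-perfect h = subst (Pow2Sum 2) 2^[1+h]-2≡ (minus 1 (plus (suc h) []))
  where
  s = size (perfect h)
  2^[1+h]≡ : 2 ^ suc h ≡ 2 + 2 * s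
  2^[1+h]≡ = trans (cong (2 *_) (sym (size-perfect h))) (ℕ.*-suc 2 s)
  cancel : ∀ x → + 2 +ℤ x -ℤ + 2 ≡ x
  cancel = solve-∀
  2^[1+h]-2≡ : + (2 ^ suc h) -ℤ + 2 ≡ + (2 * s)
  2^[1+h]-2≡ = trans (cong (λ t → + t -ℤ + 2) 2^[1+h]≡) (cancel (+ (2 * s)))

perfect-lopsided : ∀ {n par} h → LopsidedShape {n} {par} (perfect h)
perfect-lopsided zero    _ _ _ _ = lopsided 0 refl []
perfect-lopsided (suc h) = node-lopsided (double-size-perfect h) (double-size-perfect h) (perfect-lopsided h) (perfect-lopsided h)

block-lopsided : ∀ {n par} j → LopsidedShape {n} {par} (block j)
block-lopsided j = node-lopsided (double-size-perfect (2 * suc j)) [] (perfect-lopsided (2 * suc j)) (perfect-lopsided 0)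

-- Blocks 0, …, m − 1 with A, B vertices in X, Y: u and v are the total sizes of the ru blocks
-- with top in X and of the rv others, and c counts the vertices in both X and Y.
record BlocksSplit (A B m : ℕ) : Set where
  constructor blocksSplit
  field
    u v ru rv c : ℕ
    u+v      : u + v ≡ 4 * repunit₄ m
    ru+rv    : ru + rv ≡ m
    u-weight : Pow2Sum ru (+ u)
    v-weight : Pow2Sum rv (+ v)
    counts   : A + B ≡ 4 * repunit₄ m + c
    defect   : Pow2Sum (5 * c) (+ A -ℤ + B -ℤ (+ u -ℤ + v))

blocksSplit-swap : ∀ {A B m} → BlocksSplit A B m → BlocksSplit B A m
blocksSplit-swap {A} {B} (blocksSplit u v ru rv c u+v ru+rv uw vw counts defect) =
  blocksSplit v u rv ru c (trans (ℕ.+-comm v u) u+v) (trans (ℕ.+-comm rv ru) ru+rv) vw uw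
              (trans (ℕ.+-comm B A) counts) (subst (Pow2Sum _) (negate (+ A) (+ B) (+ u) (+ v)) (pow2Sum-neg defect))
  where negate : ∀ A B u v → - (A -ℤ B -ℤ (u -ℤ v)) ≡ B -ℤ A -ℤ (v -ℤ u)
        negate = solve-∀

4*repunit₄-suc : ∀ m → 4 * repunit₄ (suc m) ≡ 4 * repunit₄ m + size (block m)
4*repunit₄-suc m = begin-equality
  4 * repunit₄ (suc m)          ≡⟨ cong (4 *_) (repunit₄-suc m) ⟩
  4 * (repunit₄ m + 4 ^ m)      ≡⟨ ℕ.*-distribˡ-+ 4 (repunit₄ m) (4 ^ m) ⟩
  4 * repunit₄ m + 4 ^ suc m    ≡⟨ cong (_+_ (4 * repunit₄ m)) (sym (size-block m)) ⟩
  4 * repunit₄ m + size (block m) ∎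
  where open ℕ.≤-Reasoning

pow2Sum-size-block : ∀ j → Pow2Sum 1 (+ size (block j))
pow2Sum-size-block j =
  subst (λ s → Pow2Sum 1 (+ s)) (trans (sym (ℕ.^-*-assoc 2 2 (suc j))) (sym (size-block j))) (pow2Sum-2^ (2 * suc j))

blocksSplit-extend : ∀ {A B a b m} → BlocksSplit A B m → Lopsided a b (size (block m)) →
                     BlocksSplit (A + a) (B + b) (suc m)
blocksSplit-extend {A} {B} {a} {b} {m} (blocksSplit u v ru rv c u+v ru+rv uw vw counts defect)
                                       (lopsided c′ counts′ defect′) =
  blocksSplit (u + s) v (suc ru) rv (c + c′)
    (trans (swap u s v) (trans (cong (_+ s) u+v) (sym (4*repunit₄-suc m))))
    (cong suc ru+rv)
    (subst (λ r → Pow2Sum r (+ (u + s))) (ℕ.+-comm ru 1) (pow2Sum-+ uw (pow2Sum-size-block m)))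
    vw
    (trans (regroup A a B b) (trans (cong₂ _+_ counts counts′)
      (trans (regroup (4 * repunit₄ m) c s c′) (cong (_+ (c + c′)) (sym (4*repunit₄-suc m))))))
    (subst₂ Pow2Sum (sym (ℕ.*-distribˡ-+ 5 c c′)) (shift (+ A) (+ a) (+ B) (+ b) (+ u) (+ s) (+ v))
      (pow2Sum-- defect defect′))
  where
  s = size (block m)
  swap : ∀ u s v → u + s + v ≡ u + v + s
  swap = ℕ-solve-∀
  regroup : ∀ A a B b → A + a + (B + b) ≡ A + B + (a + b)
  regroup = ℕ-solve-∀
  shift : ∀ A a B b u s v →
          A -ℤ B -ℤ (u -ℤ v) -ℤ (s +ℤ b -ℤ a) ≡ (A +ℤ a) -ℤ (B +ℤ b) -ℤ ((u +ℤ s) -ℤ v)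
  shift = solve-∀

blocks-split : ∀ {M X Y} → CoversParent (repunit₄ (suc M)) (familyParent M) X Y → ∀ m → m ≤ M →
               BlocksSplit (count X 1 (4 * repunit₄ m)) (count Y 1 (4 * repunit₄ m)) m
blocks-split cover zero _ = blocksSplit 0 0 0 0 0 refl refl [] [] refl []
blocks-split {M} {X} {Y} cover (suc m) m<M =
  subst₂ (λ A B → BlocksSplit A B (suc m)) (sym (count-split X)) (sym (count-split Y))
    (Sum.[ extendX ∘ proj₂ , extendY ∘ proj₂ ]′ topCovered)
  where
  top = repunit₄ (suc m)
  embeds = block-embeds m<M
  bound : top + size (block m) ≤ repunit₄ (suc M)
  bound = ℕ.≤-trans (ℕ.≤-reflexive (sym (trans (repunit₄-suc (suc m)) (cong (_+_ top) (sym (size-block m))))))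
                    (repunit₄-mono-≤ (s≤s m<M))
  topCovered : Covered X Y 0 top
  topCovered = subst (λ p → Covered X Y p top) (embeds-root embeds)
                     (cover (s≤s z≤n) (ℕ.<-≤-trans (ℕ.m<m+n top (s≤s z≤n)) bound))
  ih = blocks-split cover m (ℕ.<⇒≤ m<M)
  Extended = BlocksSplit (count X 1 (4 * repunit₄ m) + count X top (size (block m)))
                         (count Y 1 (4 * repunit₄ m) + count Y top (size (block m))) (suc m)
  extendX : X top ≡ true → Extended
  extendX Xtop = blocksSplit-extend ih (block-lopsided m embeds bound cover Xtop)
  extendY : Y top ≡ true → Extended
  extendY Ytop = blocksSplit-swap
    (blocksSplit-extend (blocksSplit-swap ih) (block-lopsided m embeds bound (coversParent-swap cover) Ytop))
  count-split : ∀ Z → count Z 1 (4 * repunit₄ (suc m)) ≡ count Z 1 (4 * repunit₄ m) + count Z top (size (block m))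
  count-split Z = trans (cong (count Z 1) (4*repunit₄-suc m)) (count-+ Z 1 (4 * repunit₄ m) (size (block m)))

2*[m⊔n]≡∣m-n∣+[m+n] : ∀ m n → 2 * (m ⊔ n) ≡ ∣ m - n ∣ + (m + n)
2*[m⊔n]≡∣m-n∣+[m+n] zero    n       = cong (_+_ n) (ℕ.+-identityʳ n)
2*[m⊔n]≡∣m-n∣+[m+n] (suc m) zero    = refl
2*[m⊔n]≡∣m-n∣+[m+n] (suc m) (suc n) = begin-equality
  2 * suc (m ⊔ n)                    ≡⟨ ℕ.*-suc 2 (m ⊔ n) ⟩
  2 + 2 * (m ⊔ n)                    ≡⟨ cong (_+_ 2) (2*[m⊔n]≡∣m-n∣+[m+n] m n) ⟩
  2 + (∣ m - n ∣ + (m + n))          ≡⟨ shuffle ∣ m - n ∣ m n ⟩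
  ∣ m - n ∣ + (suc m + suc n)        ∎
  where
  open ℕ.≤-Reasoning
  shuffle : ∀ d m n → 2 + (d + (m + n)) ≡ d + (suc m + suc n)
  shuffle = ℕ-solve-∀

final-arithmetic : ∀ {R d r c m half log μ} → 1 ≤ r → m ≤ 2 * (d + r + 5 * c) → 2 * μ ≡ d + (r + (4 * R + c)) →
                   half ≤ 2 * R → log ≤ 2 * suc m → 40 * half + log ≤ 40 * μ
final-arithmetic {R} {d} {r} {c} {m} {half} {log} {μ} 1≤r m≤ 2μ≡ half≤ log≤ = ℕ.*-cancelˡ-≤ 2 (begin
  2 * (40 * half + log)
    ≤⟨ ℕ.*-monoʳ-≤ 2 (ℕ.+-mono-≤ (ℕ.*-monoʳ-≤ 40 half≤) log≤) ⟩
  2 * (40 * (2 * R) + 2 * suc m)                                  ≡⟨ expand R m ⟩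
  160 * R + 4 * 1 + 4 * m
    ≤⟨ ℕ.+-mono-≤ (ℕ.+-monoʳ-≤ (160 * R) (ℕ.*-monoʳ-≤ 4 1≤r)) (ℕ.*-monoʳ-≤ 4 m≤) ⟩
  160 * R + 4 * r + 4 * (2 * (d + r + 5 * c))                     ≤⟨ ℕ.m≤m+n _ (32 * d + 28 * r) ⟩
  160 * R + 4 * r + 4 * (2 * (d + r + 5 * c)) + (32 * d + 28 * r) ≡⟨ collect R d r c ⟩
  40 * (d + (r + (4 * R + c)))                                    ≡⟨ cong (40 *_) (sym 2μ≡) ⟩
  40 * (2 * μ)                                                    ≡⟨ swap μ ⟩
  2 * (40 * μ)                                                    ∎)
  where
  open ℕ.≤-Reasoning
  expand : ∀ R m → 2 * (40 * (2 * R) + 2 * suc m) ≡ 160 * R + 4 * 1 + 4 * m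
  expand = ℕ-solve-∀
  collect : ∀ R d r c → 160 * R + 4 * r + 4 * (2 * (d + r + 5 * c)) + (32 * d + 28 * r) ≡ 40 * (d + (r + (4 * R + c)))
  collect = ℕ-solve-∀
  swap : ∀ μ → 40 * (2 * μ) ≡ 2 * (40 * μ)
  swap = ℕ-solve-∀

root-covered : ∀ {M X Y} → CoversParent (repunit₄ (suc (suc M))) (familyParent (suc M)) X Y →
               1 ≤ boolToℕ (X 0) + boolToℕ (Y 0)
root-covered {M} {X} {Y} cover with subst (λ p → Covered X Y p 1) (embeds-root (block-embeds {0} {suc M} (s≤s z≤n)))
                                          (cover (s≤s z≤n) (s≤s (s≤s z≤n)))
... | inj₁ (X0 , _) = subst (λ b → 1 ≤ boolToℕ b + boolToℕ (Y 0)) (sym X0) (s≤s z≤n)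
... | inj₂ (Y0 , _) = subst (λ b → 1 ≤ boolToℕ (X 0) + boolToℕ b) (sym Y0) (ℕ.m≤n+m 1 (boolToℕ (X 0)))

family-cover-bound : ∀ k (V₁ V₂ : Subset (proj₁ (family k))) → Covers2 (graph (proj₂ (family k))) V₁ V₂ →
                     40 * (proj₁ (family k) / 2) + ⌊log₂ proj₁ (family k) ⌋ ≤ 40 * (∣ V₁ ∣ ⊔ ∣ V₂ ∣)
family-cover-bound k V₁ V₂ covers =
  subst₂ (λ a b → 40 * (n / 2) + ⌊log₂ n ⌋ ≤ 40 * (a ⊔ b)) (sym (∣V∣≡count V₁)) (sym (∣V∣≡count V₂))
    (final-arithmetic {repunit₄ M} {d} {r} {c} {μ = (x₀ + A) ⊔ (y₀ + B)} (root-covered cover)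
       (4*repunit₄-split-weight M u+v ru+rv u-weight v-weight u-v-weight)
       2*max≡ ([1+4x]/2≤2x (repunit₄ M)) (⌊log₂repunit₄⌋ (suc M)))
  where
  M = suc k
  n = repunit₄ (suc M)
  X = indicator V₁
  Y = indicator V₂
  cover : CoversParent n (familyParent M) X Y
  cover = ParentTree.covers2⇒coversParent (familyParent M) (familyParent-< M) (4 * repunit₄ M) covers
  open BlocksSplit (blocks-split cover M ℕ.≤-refl)
  x₀ = boolToℕ (X 0)
  y₀ = boolToℕ (Y 0)
  A = count X 1 (4 * repunit₄ M)
  B = count Y 1 (4 * repunit₄ M)
  r = x₀ + y₀
  d = ∣ x₀ + A - (y₀ + B) ∣
  u-v-weight : Pow2Sum (d + r + 5 * c) (+ u -ℤ + v)
  u-v-weight = subst (Pow2Sum _) (peel (+ x₀) (+ A) (+ y₀) (+ B) (+ u) (+ v))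
    (pow2Sum-- (pow2Sum-- (pow2Sum-∣-∣ (x₀ + A) (y₀ + B)) (pow2Sum-- (pow2Sum-ℕ x₀) (pow2Sum-ℕ y₀))) defect)
    where
    peel : ∀ x₀ A y₀ B u v → (x₀ +ℤ A) -ℤ (y₀ +ℤ B) -ℤ (x₀ -ℤ y₀) -ℤ (A -ℤ B -ℤ (u -ℤ v)) ≡ u -ℤ v
    peel = solve-∀
  2*max≡ : 2 * ((x₀ + A) ⊔ (y₀ + B)) ≡ d + (r + (4 * repunit₄ M + c))
  2*max≡ = trans (2*[m⊔n]≡∣m-n∣+[m+n] (x₀ + A) (y₀ + B))
                 (cong (_+_ d) (trans (regroup x₀ A y₀ B) (cong (_+_ r) counts)))
    where
    regroup : ∀ x₀ A y₀ B → x₀ + A + (y₀ + B) ≡ x₀ + y₀ + (A + B)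
    regroup = ℕ-solve-∀

-- The family starts with one block.
mainTheorem2 : Σ[ F ∈ (ℕ → Σ ℕ Tree) ]
                 ((∀ m → ∃[ k ] m ≤ proj₁ (F k)) ×
                  Σ[ d ∈ ℕ ] (1 ≤ d ×
                    (∀ k → 2 ≤ proj₁ (F k) →
                      ∀ (V₁ V₂ : Subset (proj₁ (F k))) →
                      Covers2 (graph (proj₂ (F k))) V₁ V₂ →
                      d * (proj₁ (F k) / 2) + ⌊log₂ proj₁ (F k) ⌋ ≤ d * (∣ V₁ ∣ ⊔ ∣ V₂ ∣))))
mainTheorem2 = family , family-unbounded , 40 , s≤s z≤n , λ k _ → family-cover-bound k
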